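{- For $m\in\mathbb{N}$ and $n\in\mathbb{N}\cup\{0\}$, \[ 1^n+3^n+\cdots+(2m-1)^n=2^n\,\frac{b_{n+1}(m)-b_{n+1}}{n+1}. \]
   Context: The type 2 Bernoulli polynomials $b_n(x)$ are defined by $\frac{t}{e^{t/2}-e^{ -t/2}}e^{xt}=\sum_{n\ge0}b_n(x)\frac{t^n}{n!}$, and $b_n=b_n(0)$. -}

module Defs where

open import Data.Nat as ℕ using (ℕ; zero; suc; _!)
open import Data.Nat.Properties using (_!≢0)
open import Data.Integer using (+_)
open import Data.Rational using (ℚ; 0ℚ; 1ℚ; ½; _+_; _*_; _-_; -_; _/_)
open import Data.List using (List; []; _∷_)

_^ℚ_ : ℚ → ℕ → ℚ
q ^ℚ zero  = 1ℚ
q ^ℚ suc n = q * (q ^ℚ n)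

invFact : ℕ → ℚ
invFact n = (+ 1 / (n !)) {{n !≢0}}

-- coefficient of t^j in e^{a t}
expCoeff : ℚ → ℕ → ℚ
expCoeff a j = (a ^ℚ j) * invFact j

-- coefficient of t^k in the power series (e^{t/2} - e^{-t/2}) / t,
-- i.e. the coefficient of t^(k+1) in e^{t/2} - e^{-t/2}.
-- Its constant coefficient D 0 equals 1.
D : ℕ → ℚ
D k = expCoeff ½ (suc k) - expCoeff (- ½) (suc k)

-- Let G(t) = Σ g_n t^n be the generating function t e^{xt} / (e^{t/2} - e^{-t/2}),
-- i.e. the unique power series with G(t) · ((e^{t/2}-e^{-t/2})/t) = e^{xt}.
-- Comparing coefficients of t^n (and using D 0 = 1):
--   g_n = [t^n] e^{xt} - Σ_{j<n} g_j · D (n - j).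
-- gs x n is the list [g_n , g_{n-1} , … , g_0].
private
  conv : ℕ → List ℚ → ℚ
  conv i []       = 0ℚ
  conv i (g ∷ gs) = g * D (suc i) + conv (suc i) gs

gs : ℚ → ℕ → List ℚ
gs x zero    = expCoeff x zero ∷ []
gs x (suc n) = (expCoeff x (suc n) - conv 0 (gs x n)) ∷ gs x n

headℚ : List ℚ → ℚ
headℚ []      = 0ℚ
headℚ (q ∷ _) = q

bPoly : ℕ → ℚ → ℚ
bPoly n x = (+ (n !) / 1) * headℚ (gs x n)

bNum : ℕ → ℚ
bNum n = bPoly n 0ℚ

ℕtoℚ : ℕ → ℚ
ℕtoℚ n = + n / 1

sumTo : ℕ → (ℕ → ℚ) → ℚ
sumTo zero    f = 0ℚ
sumTo (suc m) f = sumTo m f + f m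

{-# OPTIONS --safe #-}
-- Let G_x(t) = t e^{xt} / (e^{t/2} − e^{−t/2}) = Σ g_n(x) tⁿ, so b_n(x) = n! g_n(x), and let
-- D(t) = (e^{t/2} − e^{−t/2}) / t, so that G_x · D = e^{xt}. As D has constant term 1, a series is
-- determined by its product with D; since e^{(x+½)t} (e^{t/2} − e^{−t/2}) = e^{(x+1)t} − e^{xt},
-- this gives G_{x+1} − G_x = t e^{(x+½)t}, i.e. g_{n+1}(x+1) − g_{n+1}(x) = (x+½)ⁿ / n!.
-- Summing over x = 0, …, m−1 telescopes, and 2ⁿ n! = 2ⁿ (n+1)! / (n+1) turns (k+½)ⁿ / n! into
-- (2k+1)ⁿ. The exponential law e^{at} e^{bt} = e^{(a+b)t} on coefficients follows by induction
-- from the Leibniz rule for the formal derivative.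
module Submission where

open import Defs
open import Data.Nat using (ℕ; zero; suc; _≤_)
open import Data.Integer using (+_)
open import Data.Rational using (ℚ; _*_; _-_; _/_)
open import Relation.Binary.PropositionalEquality using (_≡_)

open import Data.Nat as ℕ using (_!; z≤n; s≤s)
import Data.Nat.Properties as ℕ
import Data.Integer as ℤ
import Data.Integer.Properties as ℤ
open import Data.Rational using (0ℚ; 1ℚ; ½; _+_; -_; toℚᵘ)
open import Data.Rational.Properties
  using ( toℚᵘ-injective; toℚᵘ-fromℚᵘ; toℚᵘ-homo-+; toℚᵘ-homo-*
        ; +-identityˡ; +-identityʳ; +-inverseʳ; +-assoc; +-comm
        ; *-identityˡ; *-identityʳ; *-zeroˡ; *-zeroʳ; *-assoc; *-comm; *-distribˡ-+; *-distribʳ-+ )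
import Data.Rational.Unnormalised as ℚᵘ
import Data.Rational.Unnormalised.Properties as ℚᵘ
open import Data.Rational.Solver using (module +-*-Solver)
open import Data.List using (List)
open import Data.Sum using (inj₁; inj₂)
open import Function using (_∘_)
open import Relation.Binary.PropositionalEquality using (refl; sym; trans; cong; cong₂; module ≡-Reasoning)

open +-*-Solver

toℚᵘ-ℕtoℚ : ∀ n → toℚᵘ (ℕtoℚ n) ℚᵘ.≃ ℚᵘ.mkℚᵘ (+ n) 0
toℚᵘ-ℕtoℚ n = toℚᵘ-fromℚᵘ (ℚᵘ.mkℚᵘ (+ n) 0)

ℕtoℚ-+ : ∀ a b → ℕtoℚ (a ℕ.+ b) ≡ ℕtoℚ a + ℕtoℚ b
ℕtoℚ-+ a b = toℚᵘ-injective (begin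
    toℚᵘ (ℕtoℚ (a ℕ.+ b))
  ≈⟨ toℚᵘ-ℕtoℚ (a ℕ.+ b) ⟩
    ℚᵘ.mkℚᵘ (+ (a ℕ.+ b)) 0
  ≈⟨ ℚᵘ.*≡* (cong (ℤ._* + 1) numerators) ⟩
    ℚᵘ.mkℚᵘ (+ a) 0 ℚᵘ.+ ℚᵘ.mkℚᵘ (+ b) 0
  ≈⟨ ℚᵘ.+-cong (toℚᵘ-ℕtoℚ a) (toℚᵘ-ℕtoℚ b) ⟨
    toℚᵘ (ℕtoℚ a) ℚᵘ.+ toℚᵘ (ℕtoℚ b)
  ≈⟨ toℚᵘ-homo-+ (ℕtoℚ a) (ℕtoℚ b) ⟨
    toℚᵘ (ℕtoℚ a + ℕtoℚ b) ∎)
  where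
  open ℚᵘ.≃-Reasoning
  numerators : + (a ℕ.+ b) ≡ + a ℤ.* + 1 ℤ.+ + b ℤ.* + 1
  numerators = trans (ℤ.pos-+ a b) (sym (cong₂ ℤ._+_ (ℤ.*-identityʳ (+ a)) (ℤ.*-identityʳ (+ b))))

ℕtoℚ-* : ∀ a b → ℕtoℚ (a ℕ.* b) ≡ ℕtoℚ a * ℕtoℚ b
ℕtoℚ-* a b = toℚᵘ-injective (begin
    toℚᵘ (ℕtoℚ (a ℕ.* b))
  ≈⟨ toℚᵘ-ℕtoℚ (a ℕ.* b) ⟩
    ℚᵘ.mkℚᵘ (+ (a ℕ.* b)) 0
  ≈⟨ ℚᵘ.*≡* (cong (ℤ._* + 1) (ℤ.pos-* a b)) ⟩
    ℚᵘ.mkℚᵘ (+ a) 0 ℚᵘ.* ℚᵘ.mkℚᵘ (+ b) 0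
  ≈⟨ ℚᵘ.*-cong (toℚᵘ-ℕtoℚ a) (toℚᵘ-ℕtoℚ b) ⟨
    toℚᵘ (ℕtoℚ a) ℚᵘ.* toℚᵘ (ℕtoℚ b)
  ≈⟨ toℚᵘ-homo-* (ℕtoℚ a) (ℕtoℚ b) ⟨
    toℚᵘ (ℕtoℚ a * ℕtoℚ b) ∎)
  where open ℚᵘ.≃-Reasoning

ℕtoℚ-suc : ∀ n → ℕtoℚ (suc n) ≡ ℕtoℚ n + 1ℚ
ℕtoℚ-suc n = trans (cong ℕtoℚ (ℕ.+-comm 1 n)) (ℕtoℚ-+ n 1)

ℕtoℚ-*-inverse : ∀ n .{{_ : ℕ.NonZero n}} → ℕtoℚ n * (+ 1 / n) ≡ 1ℚ
ℕtoℚ-*-inverse (suc d) = toℚᵘ-injective (begin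
    toℚᵘ (ℕtoℚ (suc d) * (+ 1 / suc d))
  ≈⟨ toℚᵘ-homo-* (ℕtoℚ (suc d)) (+ 1 / suc d) ⟩
    toℚᵘ (ℕtoℚ (suc d)) ℚᵘ.* toℚᵘ (+ 1 / suc d)
  ≈⟨ ℚᵘ.*-cong (toℚᵘ-ℕtoℚ (suc d)) (toℚᵘ-fromℚᵘ (ℚᵘ.mkℚᵘ (+ 1) d)) ⟩
    ℚᵘ.mkℚᵘ (+ suc d) 0 ℚᵘ.* ℚᵘ.mkℚᵘ (+ 1) d
  ≈⟨ ℚᵘ.*≡* cross-multiplied ⟩
    ℚᵘ.mkℚᵘ (+ 1) 0 ∎)
  where
  open ℚᵘ.≃-Reasoning
  cross-multiplied : (+ suc d ℤ.* + 1) ℤ.* + 1 ≡ + 1 ℤ.* + (1 ℕ.* suc d)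
  cross-multiplied = trans (trans (ℤ.*-identityʳ _) (ℤ.*-identityʳ _))
                           (sym (trans (ℤ.*-identityˡ _) (cong +_ (ℕ.*-identityˡ (suc d)))))

open ≡-Reasoning

ℕtoℚ-!-*-invFact : ∀ n → ℕtoℚ (n !) * invFact n ≡ 1ℚ
ℕtoℚ-!-*-invFact n = ℕtoℚ-*-inverse (n !) {{n ℕ.!≢0}}

*-cancelˡ-invertible : ∀ c r {p q} → c * r ≡ 1ℚ → c * p ≡ c * q → p ≡ q
*-cancelˡ-invertible c r {p} {q} cr≡1 cp≡cq = begin
  p             ≡⟨ *-identityˡ p ⟨
  1ℚ * p        ≡⟨ cong (_* p) (trans (*-comm r c) cr≡1) ⟨
  r * c * p     ≡⟨ *-assoc r c p ⟩
  r * (c * p)   ≡⟨ cong (r *_) cp≡cq ⟩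
  r * (c * q)   ≡⟨ *-assoc r c q ⟨
  r * c * q     ≡⟨ cong (_* q) (trans (*-comm r c) cr≡1) ⟩
  1ℚ * q        ≡⟨ *-identityˡ q ⟩
  q             ∎

-- Cauchy products of coefficient sequences

infixl 7 _⋆_

_⋆_ : (ℕ → ℚ) → (ℕ → ℚ) → ℕ → ℚ
(f ⋆ g) zero    = f 0 * g 0
(f ⋆ g) (suc n) = f 0 * g (suc n) + (f ∘ suc ⋆ g) n

⋆-cong : ∀ {f f′ g g′} → (∀ j → f j ≡ f′ j) → (∀ j → g j ≡ g′ j) →
         ∀ n → (f ⋆ g) n ≡ (f′ ⋆ g′) n
⋆-cong f≗f′ g≗g′ zero    = cong₂ _*_ (f≗f′ 0) (g≗g′ 0)
⋆-cong f≗f′ g≗g′ (suc n) =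
  cong₂ _+_ (cong₂ _*_ (f≗f′ 0) (g≗g′ (suc n))) (⋆-cong (f≗f′ ∘ suc) g≗g′ n)

⋆-distribʳ-+ : ∀ f f′ g n → ((λ j → f j + f′ j) ⋆ g) n ≡ (f ⋆ g) n + (f′ ⋆ g) n
⋆-distribʳ-+ f f′ g zero    = solve 3 (λ a b c → (a :+ b) :* c := a :* c :+ b :* c) refl (f 0) (f′ 0) (g 0)
⋆-distribʳ-+ f f′ g (suc n) = begin
    (f 0 + f′ 0) * g (suc n) + ((λ j → f (suc j) + f′ (suc j)) ⋆ g) n
  ≡⟨ cong (λ z → (f 0 + f′ 0) * g (suc n) + z) (⋆-distribʳ-+ (f ∘ suc) (f′ ∘ suc) g n) ⟩
    (f 0 + f′ 0) * g (suc n) + ((f ∘ suc ⋆ g) n + (f′ ∘ suc ⋆ g) n)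
  ≡⟨ solve 5 (λ a b c x y → (a :+ b) :* c :+ (x :+ y) := (a :* c :+ x) :+ (b :* c :+ y))
       refl (f 0) (f′ 0) (g (suc n)) _ _ ⟩
    (f ⋆ g) (suc n) + (f′ ⋆ g) (suc n) ∎

⋆-distribʳ-- : ∀ f f′ g n → ((λ j → f j - f′ j) ⋆ g) n ≡ (f ⋆ g) n - (f′ ⋆ g) n
⋆-distribʳ-- f f′ g zero    = solve 3 (λ a b c → (a :- b) :* c := a :* c :- b :* c) refl (f 0) (f′ 0) (g 0)
⋆-distribʳ-- f f′ g (suc n) = begin
    (f 0 - f′ 0) * g (suc n) + ((λ j → f (suc j) - f′ (suc j)) ⋆ g) n
  ≡⟨ cong (λ z → (f 0 - f′ 0) * g (suc n) + z) (⋆-distribʳ-- (f ∘ suc) (f′ ∘ suc) g n) ⟩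
    (f 0 - f′ 0) * g (suc n) + ((f ∘ suc ⋆ g) n - (f′ ∘ suc ⋆ g) n)
  ≡⟨ solve 5 (λ a b c x y → (a :- b) :* c :+ (x :- y) := (a :* c :+ x) :- (b :* c :+ y))
       refl (f 0) (f′ 0) (g (suc n)) _ _ ⟩
    (f ⋆ g) (suc n) - (f′ ⋆ g) (suc n) ∎

⋆-distribˡ-- : ∀ f g g′ n → (f ⋆ (λ j → g j - g′ j)) n ≡ (f ⋆ g) n - (f ⋆ g′) n
⋆-distribˡ-- f g g′ zero    = solve 3 (λ a b c → a :* (b :- c) := a :* b :- a :* c) refl (f 0) (g 0) (g′ 0)
⋆-distribˡ-- f g g′ (suc n) = begin
    f 0 * (g (suc n) - g′ (suc n)) + (f ∘ suc ⋆ (λ j → g j - g′ j)) n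
  ≡⟨ cong (λ z → f 0 * (g (suc n) - g′ (suc n)) + z) (⋆-distribˡ-- (f ∘ suc) g g′ n) ⟩
    f 0 * (g (suc n) - g′ (suc n)) + ((f ∘ suc ⋆ g) n - (f ∘ suc ⋆ g′) n)
  ≡⟨ solve 5 (λ a b c x y → a :* (b :- c) :+ (x :- y) := (a :* b :+ x) :- (a :* c :+ y))
       refl (f 0) (g (suc n)) (g′ (suc n)) _ _ ⟩
    (f ⋆ g) (suc n) - (f ⋆ g′) (suc n) ∎

⋆-scaleˡ : ∀ c f g n → ((λ j → c * f j) ⋆ g) n ≡ c * (f ⋆ g) n
⋆-scaleˡ c f g zero    = *-assoc c (f 0) (g 0)
⋆-scaleˡ c f g (suc n) = begin
    c * f 0 * g (suc n) + ((λ j → c * f (suc j)) ⋆ g) n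
  ≡⟨ cong₂ _+_ (*-assoc c (f 0) (g (suc n))) (⋆-scaleˡ c (f ∘ suc) g n) ⟩
    c * (f 0 * g (suc n)) + c * (f ∘ suc ⋆ g) n
  ≡⟨ *-distribˡ-+ c _ _ ⟨
    c * (f ⋆ g) (suc n) ∎

⋆-scaleʳ : ∀ c f g n → (f ⋆ (λ j → c * g j)) n ≡ c * (f ⋆ g) n
⋆-scaleʳ c f g zero    = solve 3 (λ c x y → x :* (c :* y) := c :* (x :* y)) refl c (f 0) (g 0)
⋆-scaleʳ c f g (suc n) = begin
    f 0 * (c * g (suc n)) + (f ∘ suc ⋆ (λ j → c * g j)) n
  ≡⟨ cong₂ _+_ (solve 3 (λ c x y → x :* (c :* y) := c :* (x :* y)) refl c (f 0) (g (suc n)))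
               (⋆-scaleʳ c (f ∘ suc) g n) ⟩
    c * (f 0 * g (suc n)) + c * (f ∘ suc ⋆ g) n
  ≡⟨ *-distribˡ-+ c _ _ ⟨
    c * (f ⋆ g) (suc n) ∎

⋆-sucʳ : ∀ f g n → (f ⋆ g) (suc n) ≡ (f ⋆ g ∘ suc) n + f (suc n) * g 0
⋆-sucʳ f g zero    = refl
⋆-sucʳ f g (suc n) = begin
    f 0 * g (suc (suc n)) + (f ∘ suc ⋆ g) (suc n)
  ≡⟨ cong (λ z → f 0 * g (suc (suc n)) + z) (⋆-sucʳ (f ∘ suc) g n) ⟩
    f 0 * g (suc (suc n)) + ((f ∘ suc ⋆ g ∘ suc) n + f (suc (suc n)) * g 0)
  ≡⟨ +-assoc (f 0 * g (suc (suc n))) ((f ∘ suc ⋆ g ∘ suc) n) (f (suc (suc n)) * g 0) ⟨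
    (f ⋆ g ∘ suc) (suc n) + f (suc (suc n)) * g 0 ∎

prefix≡0⇒⋆≡0 : ∀ w h n → (∀ j → j ≤ n → w j ≡ 0ℚ) → (w ⋆ h) n ≡ 0ℚ
prefix≡0⇒⋆≡0 w h zero    w≡0 = trans (cong (_* h 0) (w≡0 0 z≤n)) (*-zeroˡ (h 0))
prefix≡0⇒⋆≡0 w h (suc n) w≡0 = begin
    w 0 * h (suc n) + (w ∘ suc ⋆ h) n
  ≡⟨ cong₂ _+_ (cong (_* h (suc n)) (w≡0 0 z≤n))
               (prefix≡0⇒⋆≡0 (w ∘ suc) h n (λ j j≤n → w≡0 (suc j) (s≤s j≤n))) ⟩
    0ℚ * h (suc n) + 0ℚ
  ≡⟨ trans (+-identityʳ _) (*-zeroˡ (h (suc n))) ⟩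
    0ℚ ∎

⋆≡0⇒≡0 : ∀ {w h} → h 0 ≡ 1ℚ → (∀ n → (w ⋆ h) n ≡ 0ℚ) → ∀ n → w n ≡ 0ℚ
⋆≡0⇒≡0 {w} {h} h0≡1 w⋆h≡0 n = prefix n n ℕ.≤-refl
  where
  prefix : ∀ n j → j ≤ n → w j ≡ 0ℚ
  prefix zero    zero z≤n = begin
    w 0           ≡⟨ *-identityʳ (w 0) ⟨
    w 0 * 1ℚ      ≡⟨ cong (w 0 *_) h0≡1 ⟨
    (w ⋆ h) 0     ≡⟨ w⋆h≡0 0 ⟩
    0ℚ            ∎
  prefix (suc n) j j≤1+n with ℕ.m≤n⇒m<n∨m≡n j≤1+n
  ... | inj₁ (s≤s j≤n) = prefix n j j≤n
  ... | inj₂ refl = begin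
      w (suc n)
    ≡⟨ trans (+-identityˡ _) (*-identityʳ (w (suc n))) ⟨
      0ℚ + w (suc n) * 1ℚ
    ≡⟨ cong₂ (λ a b → a + w (suc n) * b) (prefix≡0⇒⋆≡0 w (h ∘ suc) n (prefix n)) h0≡1 ⟨
      (w ⋆ h ∘ suc) n + w (suc n) * h 0
    ≡⟨ ⋆-sucʳ w h n ⟨
      (w ⋆ h) (suc n)
    ≡⟨ w⋆h≡0 (suc n) ⟩
      0ℚ ∎

⋆-cancelʳ : ∀ {h} → h 0 ≡ 1ℚ → ∀ u v → (∀ n → (u ⋆ h) n ≡ (v ⋆ h) n) → ∀ n → u n ≡ v n
⋆-cancelʳ {h} h0≡1 u v u⋆h≡v⋆h n = begin
    u n                ≡⟨ solve 2 (λ a b → a := (a :- b) :+ b) refl (u n) (v n) ⟩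
    (u n - v n) + v n  ≡⟨ cong (_+ v n) (⋆≡0⇒≡0 h0≡1 difference n) ⟩
    0ℚ + v n           ≡⟨ +-identityˡ (v n) ⟩
    v n                ∎
  where
  difference : ∀ m → ((λ j → u j - v j) ⋆ h) m ≡ 0ℚ
  difference m = begin
    ((λ j → u j - v j) ⋆ h) m  ≡⟨ ⋆-distribʳ-- u v h m ⟩
    (u ⋆ h) m - (v ⋆ h) m      ≡⟨ cong (_- (v ⋆ h) m) (u⋆h≡v⋆h m) ⟩
    (v ⋆ h) m - (v ⋆ h) m      ≡⟨ +-inverseʳ ((v ⋆ h) m) ⟩
    0ℚ                         ∎

timesT : (ℕ → ℚ) → ℕ → ℚ
timesT f zero    = 0ℚ
timesT f (suc j) = f j

timesT-⋆ : ∀ f g n → (timesT f ⋆ g) (suc n) ≡ (f ⋆ g) n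
timesT-⋆ f g n = trans (cong (_+ (f ⋆ g) n) (*-zeroˡ (g (suc n)))) (+-identityˡ ((f ⋆ g) n))

-- Formal derivative and exponential series

deriv : (ℕ → ℚ) → ℕ → ℚ
deriv f j = ℕtoℚ (suc j) * f (suc j)

deriv-suc : ∀ f j → deriv f (suc j) ≡ deriv (f ∘ suc) j + f (suc (suc j))
deriv-suc f j = begin
  ℕtoℚ (suc (suc j)) * f (suc (suc j))              ≡⟨ cong (_* f (suc (suc j))) (ℕtoℚ-suc (suc j)) ⟩
  (ℕtoℚ (suc j) + 1ℚ) * f (suc (suc j))             ≡⟨ *-distribʳ-+ (f (suc (suc j))) (ℕtoℚ (suc j)) 1ℚ ⟩
  deriv (f ∘ suc) j + 1ℚ * f (suc (suc j))          ≡⟨ cong (λ z → deriv (f ∘ suc) j + z) (*-identityˡ _) ⟩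
  deriv (f ∘ suc) j + f (suc (suc j))               ∎

deriv-⋆ : ∀ f g n → deriv (f ⋆ g) n ≡ (deriv f ⋆ g) n + (f ⋆ deriv g) n
deriv-⋆ f g zero = solve 5 (λ N a b a′ b′ → N :* (a :* b′ :+ a′ :* b) := (N :* a′) :* b :+ a :* (N :* b′))
  refl (ℕtoℚ 1) (f 0) (g 0) (f 1) (g 1)
deriv-⋆ f g (suc n) = begin
    ℕtoℚ (suc (suc n)) * (f 0 * g (suc (suc n)) + X)
  ≡⟨ cong (_* (f 0 * g (suc (suc n)) + X)) (ℕtoℚ-suc (suc n)) ⟩
    (N + 1ℚ) * (f 0 * g (suc (suc n)) + X)
  ≡⟨ solve 4 (λ N a b X → (N :+ con 1ℚ) :* (a :* b :+ X) := a :* ((N :+ con 1ℚ) :* b) :+ (N :* X :+ X))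
       refl N (f 0) (g (suc (suc n))) X ⟩
    f 0 * ((N + 1ℚ) * g (suc (suc n))) + (N * X + X)
  ≡⟨ cong₂ (λ c y → f 0 * (c * g (suc (suc n))) + (y + X))
       (sym (ℕtoℚ-suc (suc n))) (deriv-⋆ (f ∘ suc) g n) ⟩
    f 0 * deriv g (suc n) + ((deriv (f ∘ suc) ⋆ g) n + (f ∘ suc ⋆ deriv g) n + X)
  ≡⟨ solve 6 (λ a d A B C y → a :* d :+ (A :+ C :+ (y :+ B)) := (y :+ (A :+ B)) :+ (a :* d :+ C))
       refl (f 0) (deriv g (suc n)) ((deriv (f ∘ suc) ⋆ g) n) ((f ∘ suc ∘ suc ⋆ g) n)
       ((f ∘ suc ⋆ deriv g) n) (f 1 * g (suc n)) ⟩
    (f 1 * g (suc n) + ((deriv (f ∘ suc) ⋆ g) n + (f ∘ suc ∘ suc ⋆ g) n)) + (f ⋆ deriv g) (suc n)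
  ≡⟨ cong (_+ (f ⋆ deriv g) (suc n)) (cong₂ _+_ (cong (_* g (suc n)) (*-identityˡ (f 1))) derivTail) ⟨
    (deriv f ⋆ g) (suc n) + (f ⋆ deriv g) (suc n) ∎
  where
  N X : ℚ
  N = ℕtoℚ (suc n)
  X = (f ∘ suc ⋆ g) (suc n)
  derivTail : (deriv f ∘ suc ⋆ g) n ≡ (deriv (f ∘ suc) ⋆ g) n + (f ∘ suc ∘ suc ⋆ g) n
  derivTail = trans (⋆-cong (deriv-suc f) (λ _ → refl) n) (⋆-distribʳ-+ (deriv (f ∘ suc)) (f ∘ suc ∘ suc) g n)

invFact-suc : ∀ j → ℕtoℚ (suc j) * invFact (suc j) ≡ invFact j
invFact-suc j = *-cancelˡ-invertible (ℕtoℚ (j !)) (invFact j) (ℕtoℚ-!-*-invFact j) (begin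
    ℕtoℚ (j !) * (ℕtoℚ (suc j) * invFact (suc j))
  ≡⟨ solve 3 (λ a b c → a :* (b :* c) := (b :* a) :* c) refl (ℕtoℚ (j !)) (ℕtoℚ (suc j)) (invFact (suc j)) ⟩
    ℕtoℚ (suc j) * ℕtoℚ (j !) * invFact (suc j)
  ≡⟨ cong (_* invFact (suc j)) (ℕtoℚ-* (suc j) (j !)) ⟨
    ℕtoℚ (suc j !) * invFact (suc j)
  ≡⟨ trans (ℕtoℚ-!-*-invFact (suc j)) (sym (ℕtoℚ-!-*-invFact j)) ⟩
    ℕtoℚ (j !) * invFact j ∎)

deriv-expCoeff : ∀ a j → deriv (expCoeff a) j ≡ a * expCoeff a j
deriv-expCoeff a j = begin
    ℕtoℚ (suc j) * (a * a ^ℚ j * invFact (suc j))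
  ≡⟨ solve 4 (λ N a p i → N :* (a :* p :* i) := a :* (p :* (N :* i)))
       refl (ℕtoℚ (suc j)) a (a ^ℚ j) (invFact (suc j)) ⟩
    a * (a ^ℚ j * (ℕtoℚ (suc j) * invFact (suc j)))
  ≡⟨ cong (λ z → a * (a ^ℚ j * z)) (invFact-suc j) ⟩
    a * expCoeff a j ∎

expCoeff-⋆ : ∀ a b n → (expCoeff a ⋆ expCoeff b) n ≡ expCoeff (a + b) n
expCoeff-⋆ a b zero    = refl
expCoeff-⋆ a b (suc n) = *-cancelˡ-invertible (ℕtoℚ (suc n)) (+ 1 / suc n) (ℕtoℚ-*-inverse (suc n)) (begin
    deriv (expCoeff a ⋆ expCoeff b) n
  ≡⟨ deriv-⋆ (expCoeff a) (expCoeff b) n ⟩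
    (deriv (expCoeff a) ⋆ expCoeff b) n + (expCoeff a ⋆ deriv (expCoeff b)) n
  ≡⟨ cong₂ _+_ (trans (⋆-cong (deriv-expCoeff a) (λ _ → refl) n) (⋆-scaleˡ a (expCoeff a) (expCoeff b) n))
               (trans (⋆-cong (λ _ → refl) (deriv-expCoeff b) n) (⋆-scaleʳ b (expCoeff a) (expCoeff b) n)) ⟩
    a * (expCoeff a ⋆ expCoeff b) n + b * (expCoeff a ⋆ expCoeff b) n
  ≡⟨ *-distribʳ-+ _ a b ⟨
    (a + b) * (expCoeff a ⋆ expCoeff b) n
  ≡⟨ cong ((a + b) *_) (expCoeff-⋆ a b n) ⟩
    (a + b) * expCoeff (a + b) n
  ≡⟨ deriv-expCoeff (a + b) n ⟨
    deriv (expCoeff (a + b)) n ∎)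

expCoeff-⋆-suc : ∀ a b n → (expCoeff a ⋆ expCoeff b ∘ suc) n ≡ expCoeff (a + b) (suc n) - expCoeff a (suc n)
expCoeff-⋆-suc a b n = begin
    (expCoeff a ⋆ expCoeff b ∘ suc) n
  ≡⟨ solve 2 (λ s e → s := (s :+ e :* con 1ℚ) :- e)
       refl ((expCoeff a ⋆ expCoeff b ∘ suc) n) (expCoeff a (suc n)) ⟩
    ((expCoeff a ⋆ expCoeff b ∘ suc) n + expCoeff a (suc n) * expCoeff b 0) - expCoeff a (suc n)
  ≡⟨ cong (_- expCoeff a (suc n)) (trans (sym (⋆-sucʳ (expCoeff a) (expCoeff b) n)) (expCoeff-⋆ a b (suc n))) ⟩
    expCoeff (a + b) (suc n) - expCoeff a (suc n) ∎

expCoeff-⋆-D : ∀ c n → (expCoeff c ⋆ D) n ≡ expCoeff (c + ½) (suc n) - expCoeff (c - ½) (suc n)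
expCoeff-⋆-D c n = begin
    (expCoeff c ⋆ D) n
  ≡⟨ ⋆-distribˡ-- (expCoeff c) (expCoeff ½ ∘ suc) (expCoeff (- ½) ∘ suc) n ⟩
    (expCoeff c ⋆ expCoeff ½ ∘ suc) n - (expCoeff c ⋆ expCoeff (- ½) ∘ suc) n
  ≡⟨ cong₂ _-_ (expCoeff-⋆-suc c ½ n) (expCoeff-⋆-suc c (- ½) n) ⟩
    (expCoeff (c + ½) (suc n) - e) - (expCoeff (c - ½) (suc n) - e)
  ≡⟨ solve 3 (λ p q e → (p :- e) :- (q :- e) := p :- q)
       refl (expCoeff (c + ½) (suc n)) (expCoeff (c - ½) (suc n)) e ⟩
    expCoeff (c + ½) (suc n) - expCoeff (c - ½) (suc n) ∎
  where
  e : ℚ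
  e = expCoeff c (suc n)

timesT-expCoeff-⋆-D : ∀ x n → (timesT (expCoeff (x + ½)) ⋆ D) n ≡ expCoeff (x + 1ℚ) n - expCoeff x n
timesT-expCoeff-⋆-D x zero    = refl
timesT-expCoeff-⋆-D x (suc n) = begin
    (timesT (expCoeff (x + ½)) ⋆ D) (suc n)
  ≡⟨ timesT-⋆ (expCoeff (x + ½)) D n ⟩
    (expCoeff (x + ½) ⋆ D) n
  ≡⟨ expCoeff-⋆-D (x + ½) n ⟩
    expCoeff (x + ½ + ½) (suc n) - expCoeff (x + ½ - ½) (suc n)
  ≡⟨ cong₂ (λ a b → expCoeff a (suc n) - expCoeff b (suc n))
       (solve 1 (λ x → x :+ con ½ :+ con ½ := x :+ con 1ℚ) refl x)
       (solve 1 (λ x → x :+ con ½ :- con ½ := x) refl x) ⟩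
    expCoeff (x + 1ℚ) (suc n) - expCoeff x (suc n) ∎

bSeries : ℚ → ℕ → ℚ
bSeries x n = headℚ (gs x n)

-- Defs keeps the convolution used by gs private. This meta names it: the with-abstraction
-- below turns its arguments into variables, so unification solves it to that function.
mutual
  conv : ℕ → List ℚ → ℚ
  conv = _

  bSeries-suc : ∀ x n → bSeries x (suc n) ≡ expCoeff x (suc n) - conv 0 (gs x n)
  bSeries-suc x n with expCoeff x (suc n) | gs x n | 0
  ... | e | l | i = refl

conv-gs : ∀ x n i → conv i (gs x n) ≡ (bSeries x ⋆ (λ m → D (suc (m ℕ.+ i)))) n
conv-gs x zero    i = +-identityʳ _
conv-gs x (suc n) i = begin
    bSeries x (suc n) * D (suc i) + conv (suc i) (gs x n)
  ≡⟨ cong (λ z → bSeries x (suc n) * D (suc i) + z)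
       (trans (conv-gs x n (suc i)) (⋆-cong (λ _ → refl) (λ m → cong (D ∘ suc) (ℕ.+-suc m i)) n)) ⟩
    bSeries x (suc n) * D (suc i) + (bSeries x ⋆ (λ m → D (suc (suc m ℕ.+ i)))) n
  ≡⟨ +-comm (bSeries x (suc n) * D (suc i)) _ ⟩
    (bSeries x ⋆ (λ m → D (suc (suc m ℕ.+ i)))) n + bSeries x (suc n) * D (suc i)
  ≡⟨ ⋆-sucʳ (bSeries x) (λ m → D (suc (m ℕ.+ i))) n ⟨
    (bSeries x ⋆ (λ m → D (suc (m ℕ.+ i)))) (suc n) ∎

bSeries-⋆-D : ∀ x n → (bSeries x ⋆ D) n ≡ expCoeff x n
bSeries-⋆-D x zero    = refl
bSeries-⋆-D x (suc n) = begin
    (bSeries x ⋆ D) (suc n)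
  ≡⟨ ⋆-sucʳ (bSeries x) D n ⟩
    (bSeries x ⋆ D ∘ suc) n + bSeries x (suc n) * 1ℚ
  ≡⟨ cong₂ (λ a b → a + b * 1ℚ) (sym conv-gs-0) (bSeries-suc x n) ⟩
    conv 0 (gs x n) + (expCoeff x (suc n) - conv 0 (gs x n)) * 1ℚ
  ≡⟨ solve 2 (λ c e → c :+ (e :- c) :* con 1ℚ := e) refl (conv 0 (gs x n)) (expCoeff x (suc n)) ⟩
    expCoeff x (suc n) ∎
  where
  conv-gs-0 : conv 0 (gs x n) ≡ (bSeries x ⋆ D ∘ suc) n
  conv-gs-0 = trans (conv-gs x n 0) (⋆-cong (λ _ → refl) (λ m → cong (D ∘ suc) (ℕ.+-identityʳ m)) n)

bSeries-difference : ∀ x n → bSeries (x + 1ℚ) n - bSeries x n ≡ timesT (expCoeff (x + ½)) n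
bSeries-difference x =
  ⋆-cancelʳ {D} refl (λ j → bSeries (x + 1ℚ) j - bSeries x j) (timesT (expCoeff (x + ½))) λ n → begin
    ((λ j → bSeries (x + 1ℚ) j - bSeries x j) ⋆ D) n
  ≡⟨ ⋆-distribʳ-- (bSeries (x + 1ℚ)) (bSeries x) D n ⟩
    (bSeries (x + 1ℚ) ⋆ D) n - (bSeries x ⋆ D) n
  ≡⟨ cong₂ _-_ (bSeries-⋆-D (x + 1ℚ) n) (bSeries-⋆-D x n) ⟩
    expCoeff (x + 1ℚ) n - expCoeff x n
  ≡⟨ timesT-expCoeff-⋆-D x n ⟨
    (timesT (expCoeff (x + ½)) ⋆ D) n ∎

-- Telescoping

sumTo-cong : ∀ m {f g : ℕ → ℚ} → (∀ k → f k ≡ g k) → sumTo m f ≡ sumTo m g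
sumTo-cong zero    f≗g = refl
sumTo-cong (suc m) f≗g = cong₂ _+_ (sumTo-cong m f≗g) (f≗g m)

*-distribˡ-sumTo : ∀ c m (f : ℕ → ℚ) → c * sumTo m f ≡ sumTo m (λ k → c * f k)
*-distribˡ-sumTo c zero    f = *-zeroʳ c
*-distribˡ-sumTo c (suc m) f =
  trans (*-distribˡ-+ c (sumTo m f) (f m)) (cong (_+ c * f m) (*-distribˡ-sumTo c m f))

sumTo-telescope : ∀ (F : ℕ → ℚ) m → F m - F 0 ≡ sumTo m (λ k → F (suc k) - F k)
sumTo-telescope F zero    = +-inverseʳ (F 0)
sumTo-telescope F (suc m) = begin
    F (suc m) - F 0
  ≡⟨ solve 3 (λ a b c → a :- c := (b :- c) :+ (a :- b)) refl (F (suc m)) (F m) (F 0) ⟩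
    (F m - F 0) + (F (suc m) - F m)
  ≡⟨ cong (_+ (F (suc m) - F m)) (sumTo-telescope F m) ⟩
    sumTo (suc m) (λ k → F (suc k) - F k) ∎

bSeries-telescope : ∀ m n → bSeries (ℕtoℚ m) (suc n) - bSeries 0ℚ (suc n)
                           ≡ sumTo m (λ k → expCoeff (ℕtoℚ k + ½) n)
bSeries-telescope m n = trans (sumTo-telescope (λ k → bSeries (ℕtoℚ k) (suc n)) m) (sumTo-cong m step)
  where
  step : ∀ k → bSeries (ℕtoℚ (suc k)) (suc n) - bSeries (ℕtoℚ k) (suc n) ≡ expCoeff (ℕtoℚ k + ½) n
  step k = trans (cong (λ y → bSeries y (suc n) - bSeries (ℕtoℚ k) (suc n)) (ℕtoℚ-suc k))
                 (bSeries-difference (ℕtoℚ k) (suc n))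

^ℚ-distrib-* : ∀ p q n → (p * q) ^ℚ n ≡ (p ^ℚ n) * (q ^ℚ n)
^ℚ-distrib-* p q zero    = refl
^ℚ-distrib-* p q (suc n) = trans (cong ((p * q) *_) (^ℚ-distrib-* p q n))
  (solve 4 (λ p q a b → (p :* q) :* (a :* b) := (p :* a) :* (q :* b)) refl p q (p ^ℚ n) (q ^ℚ n))

ℕtoℚ-odd : ∀ k → ℕtoℚ (2 ℕ.* k ℕ.+ 1) ≡ ℕtoℚ 2 * (ℕtoℚ k + ½)
ℕtoℚ-odd k = begin
    ℕtoℚ (2 ℕ.* k ℕ.+ 1)
  ≡⟨ ℕtoℚ-+ (2 ℕ.* k) 1 ⟩
    ℕtoℚ (2 ℕ.* k) + 1ℚ
  ≡⟨ cong (_+ 1ℚ) (ℕtoℚ-* 2 k) ⟩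
    ℕtoℚ 2 * ℕtoℚ k + 1ℚ
  ≡⟨ solve 1 (λ k → con (ℕtoℚ 2) :* k :+ con 1ℚ := con (ℕtoℚ 2) :* (k :+ con ½)) refl (ℕtoℚ k) ⟩
    ℕtoℚ 2 * (ℕtoℚ k + ½) ∎

odd-^≡scaled-expCoeff : ∀ n k → ℕtoℚ (2 ℕ.* k ℕ.+ 1) ^ℚ n
                        ≡ ℕtoℚ 2 ^ℚ n * ℕtoℚ (suc n !) * (+ 1 / suc n) * expCoeff (ℕtoℚ k + ½) n
odd-^≡scaled-expCoeff n k = begin
    ℕtoℚ (2 ℕ.* k ℕ.+ 1) ^ℚ n
  ≡⟨ trans (cong (_^ℚ n) (ℕtoℚ-odd k)) (^ℚ-distrib-* (ℕtoℚ 2) (ℕtoℚ k + ½) n) ⟩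
    t * y
  ≡⟨ trans (cong (t * y *_) factorials-cancel) (*-identityʳ (t * y)) ⟨
    t * y * (ℕtoℚ (suc n !) * r * invFact n)
  ≡⟨ solve 5 (λ t y f r i → t :* y :* (f :* r :* i) := t :* f :* r :* (y :* i))
       refl t y (ℕtoℚ (suc n !)) r (invFact n) ⟩
    t * ℕtoℚ (suc n !) * r * expCoeff (ℕtoℚ k + ½) n ∎
  where
  t y r : ℚ
  t = ℕtoℚ 2 ^ℚ n
  y = (ℕtoℚ k + ½) ^ℚ n
  r = + 1 / suc n
  factorials-cancel : ℕtoℚ (suc n !) * r * invFact n ≡ 1ℚ
  factorials-cancel = begin
      ℕtoℚ (suc n !) * r * invFact n
    ≡⟨ cong (λ f → f * r * invFact n) (ℕtoℚ-* (suc n) (n !)) ⟩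
      ℕtoℚ (suc n) * ℕtoℚ (n !) * r * invFact n
    ≡⟨ solve 4 (λ a b r i → a :* b :* r :* i := (a :* r) :* (b :* i))
         refl (ℕtoℚ (suc n)) (ℕtoℚ (n !)) r (invFact n) ⟩
      (ℕtoℚ (suc n) * r) * (ℕtoℚ (n !) * invFact n)
    ≡⟨ cong₂ _*_ (ℕtoℚ-*-inverse (suc n)) (ℕtoℚ-!-*-invFact n) ⟩
      1ℚ * 1ℚ
    ≡⟨⟩
      1ℚ ∎

theorem2p6 : (m n : ℕ) → 1 ≤ m →
    sumTo m (λ k → ℕtoℚ (2 Data.Nat.* k Data.Nat.+ 1) ^ℚ n)
      ≡ ((ℕtoℚ 2 ^ℚ n) * (bPoly (suc n) (ℕtoℚ m) - bNum (suc n))) * (+ 1 / suc n)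
theorem2p6 m n _ = begin
    sumTo m (λ k → ℕtoℚ (2 ℕ.* k ℕ.+ 1) ^ℚ n)
  ≡⟨ sumTo-cong m (odd-^≡scaled-expCoeff n) ⟩
    sumTo m (λ k → c * expCoeff (ℕtoℚ k + ½) n)
  ≡⟨ *-distribˡ-sumTo c m (λ k → expCoeff (ℕtoℚ k + ½) n) ⟨
    c * sumTo m (λ k → expCoeff (ℕtoℚ k + ½) n)
  ≡⟨ cong (c *_) (bSeries-telescope m n) ⟨
    c * (bSeries (ℕtoℚ m) (suc n) - bSeries 0ℚ (suc n))
  ≡⟨ solve 5 (λ t f r a b → t :* f :* r :* (a :- b) := (t :* (f :* a :- f :* b)) :* r)
       refl (ℕtoℚ 2 ^ℚ n) (ℕtoℚ (suc n !)) (+ 1 / suc n) (bSeries (ℕtoℚ m) (suc n)) (bSeries 0ℚ (suc n)) ⟩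
    ((ℕtoℚ 2 ^ℚ n) * (bPoly (suc n) (ℕtoℚ m) - bNum (suc n))) * (+ 1 / suc n) ∎
  where
  c : ℚ
  c = ℕtoℚ 2 ^ℚ n * ℕtoℚ (suc n !) * (+ 1 / suc n)
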